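{- Let $w\in S_n$ be $321$-avoiding. Then the map $\phi:\mathrm{FSVT}(D(w))\to\mathrm{FSVT}(\overline{D(w)})$, defined for $T\in\mathrm{FSVT}(D(w))$ and $(r,c)\in\overline{D(w)}$ by $\phi(T)(r,c)=T(r,c)$ if $(r,c)\in D(w)$ and $\phi(T)(r,c)=\{r\}$ otherwise, is well defined (i.e. $\phi(T)\in\mathrm{FSVT}(\overline{D(w)})$) and injective.
   Context: $w\in S_n$ is $321$-avoiding if there are no $a<b<c$ with $w(a)>w(b)>w(c)$. Boxes $(i,j)\in[n]\times[n]$ are in row $i$, column $j$, with rows increasing southward. Rothe diagram: $D(w)=\{(i,j)\in[n]\times[n]: w_i>j \text{ and } w^{ -1}_j>i\}$. Its southwest hook closure is $\overline{D(w)}=\{(i,j): (i,j+k)\in D(w) \text{ and } (i-k',j)\in D(w) \text{ for some } k,k'\ge0\}$. For $D\subseteq[n]\times[n]$, a flagged set-valued tableau for $D$ is a map $f$ from $D$ to nonempty subsets of $[n]$ such that: $\min f(r,c)\ge\max f(r,c+k)$ whenever $(r,c),(r,c+k)\in D$, $k>0$; $\max f(r,c)<\min f(r+k,c)$ whenever $(r,c),(r+k,c)\in D$, $k>0$; and $\max f(r,c)\le r$ for all $(r,c)\in D$. $\mathrm{FSVT}(D)$ denotes the set of such tableaux. -}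

module Defs where

open import Data.Nat using (ℕ)
open import Data.Fin using (Fin; toℕ; _<_; _≤_; _>_; _<?_)
open import Data.Fin.Subset using (Subset; _∈_; Nonempty; ⁅_⁆)
open import Data.Fin.Permutation using (Permutation′; _⟨$⟩ʳ_; _⟨$⟩ˡ_)
open import Data.Product using (Σ; _×_; _,_)
open import Relation.Nullary using (¬_; Dec; yes; no)
open import Relation.Nullary.Decidable using (_×-dec_)

-- Conventions: [n] is represented by Fin n (0-indexed; the shift by one is
-- order-preserving, so all comparisons are unchanged).  A box (i , j) is
-- row i, column j.

Diagram : ℕ → Set₁
Diagram n = Fin n → Fin n → Set

Avoids321 : ∀ {n} → Permutation′ n → Set
Avoids321 {n} w =
  ¬ (Σ (Fin n) λ a → Σ (Fin n) λ b → Σ (Fin n) λ c →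
       a < b × b < c × (w ⟨$⟩ʳ a) > (w ⟨$⟩ʳ b) × (w ⟨$⟩ʳ b) > (w ⟨$⟩ʳ c))

Rothe : ∀ {n} → Permutation′ n → Diagram n
Rothe w i j = (w ⟨$⟩ʳ i) > j × (w ⟨$⟩ˡ j) > i

Rothe? : ∀ {n} (w : Permutation′ n) (i j : Fin n) → Dec (Rothe w i j)
Rothe? w i j = (j <? (w ⟨$⟩ʳ i)) ×-dec (i <? (w ⟨$⟩ˡ j))

Closure : ∀ {n} → Diagram n → Diagram n
Closure {n} D i j =
  (Σ (Fin n) λ j' → j ≤ j' × D i j') × (Σ (Fin n) λ i' → i' ≤ i × D i' j)

Filling : ∀ {n} → Diagram n → Set
Filling {n} D = (i j : Fin n) → D i j → Subset n

-- flagged set-valued tableau conditions;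
-- "min A ≥ max B" / "max A < min B" for nonempty sets are written elementwise.
record IsFSVT {n} (D : Diagram n) (f : Filling D) : Set where
  field
    nonempty : ∀ r c (p : D r c) → Nonempty (f r c p)
    rows     : ∀ r c c' (p : D r c) (p' : D r c') → c < c' →
               ∀ a b → a ∈ f r c p → b ∈ f r c' p' → b ≤ a
    columns  : ∀ r r' c (p : D r c) (p' : D r' c) → r < r' →
               ∀ a b → a ∈ f r c p → b ∈ f r' c p' → a < b
    flagged  : ∀ r c (p : D r c) → ∀ a → a ∈ f r c p → a ≤ r

φ : ∀ {n} (w : Permutation′ n) → Filling (Rothe w) → Filling (Closure (Rothe w))
φ w T r c _ with Rothe? w r c
... | yes p = T r c p
... | no _  = ⁅ r ⁆

{-# OPTIONS --safe #-}
module Submission where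

-- Every box (r , c) of the closure that is not in D(w) satisfies
-- c < w r, hence w⁻¹ c ≤ r: such a box lies below every box of D(w) in its
-- column.  If it also lay east of a box (r , c₀) of D(w), and (i , c) is the
-- box of D(w) above it, then i < w⁻¹ c < w⁻¹ c₀ carry the values
-- w i > c > c₀, a 321-pattern.  So the new boxes sit south-west of the old
-- ones, where the flag bound max T ≤ r of the old boxes makes the singleton
-- {r} compatible with both the row and the column conditions.

open import Defs
open import Data.Nat using (ℕ)
import Data.Nat.Properties as ℕ
open import Data.Fin using (toℕ; _≤_; _<_)
open import Data.Fin.Subset using (_∈_; Nonempty; ⁅_⁆)
open import Data.Fin.Subset.Properties using (x∈⁅x⁆; x∈⁅y⁆⇒x≡y)
open import Data.Fin.Permutation using (Permutation′; _⟨$⟩ʳ_; _⟨$⟩ˡ_; inverseʳ)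
open import Data.Product using (_×_; _,_)
open import Data.Empty using (⊥-elim)
open import Relation.Nullary using (¬_; Dec; yes; no)
open import Relation.Binary.PropositionalEquality using (_≡_; refl; sym; cong; cong₂; subst; subst₂; module ≡-Reasoning)

record IsSingletonExtension {n} {D E : Diagram n}
         (T : Filling D) (F : Filling E) : Set where
  field
    on-old : ∀ r c (q : E r c) (p : D r c) → F r c q ≡ T r c p
    on-new : ∀ r c (q : E r c) → ¬ D r c → F r c q ≡ ⁅ r ⁆

module _ {n} {D E : Diagram n} {T : Filling D} {F : Filling E}
         (ext : IsSingletonExtension T F) where

  open IsSingletonExtension ext

  singletonExtension-injective :
    ∀ {T′ : Filling D} {F′ : Filling E} → IsSingletonExtension T′ F′ →
    (∀ {r c} → D r c → E r c) →
    (∀ r c q → F r c q ≡ F′ r c q) → ∀ r c p → T r c p ≡ T′ r c p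
  singletonExtension-injective {T′} {F′} ext′ D⊆E F≗F′ r c p = begin
    T r c p        ≡⟨ sym (on-old r c (D⊆E p) p) ⟩
    F r c (D⊆E p)  ≡⟨ F≗F′ r c (D⊆E p) ⟩
    F′ r c (D⊆E p) ≡⟨ IsSingletonExtension.on-old ext′ r c (D⊆E p) p ⟩
    T′ r c p       ∎
    where open ≡-Reasoning

  singletonExtension-isFSVT :
    (∀ r c → Dec (D r c)) → IsFSVT D T →
    (∀ {r c c′} → D r c → ¬ D r c′ → E r c′ → ¬ c < c′) →
    (∀ {r r′ c} → ¬ D r c → E r c → D r′ c → ¬ r < r′) →
    IsFSVT E F
  singletonExtension-isFSVT D? fsvt new-west new-south = record
    { nonempty = nonempty
    ; rows     = rows
    ; columns  = columns
    ; flagged  = flagged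
    }
    where
      module T = IsFSVT fsvt

      ∈-old : ∀ {r c a} q p → a ∈ F r c q → a ∈ T r c p
      ∈-old {r} {c} q p = subst (_ ∈_) (on-old r c q p)

      ∈-new : ∀ {r c a} q → ¬ D r c → a ∈ F r c q → a ≡ r
      ∈-new {r} {c} q ¬p a∈ = x∈⁅y⁆⇒x≡y r (subst (_ ∈_) (on-new r c q ¬p) a∈)

      nonempty : ∀ r c q → Nonempty (F r c q)
      nonempty r c q with D? r c
      ... | yes p = subst Nonempty (sym (on-old r c q p)) (T.nonempty r c p)
      ... | no ¬p = r , subst (r ∈_) (sym (on-new r c q ¬p)) (x∈⁅x⁆ r)

      flagged : ∀ r c q a → a ∈ F r c q → a ≤ r
      flagged r c q a a∈ with D? r c
      ... | yes p = T.flagged r c p a (∈-old q p a∈)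
      ... | no ¬p = ℕ.≤-reflexive (cong toℕ (∈-new q ¬p a∈))

      rows : ∀ r c c′ q q′ → c < c′ → ∀ a b → a ∈ F r c q → b ∈ F r c′ q′ →
             b ≤ a
      rows r c c′ q q′ c<c′ a b a∈ b∈ with D? r c | D? r c′
      ... | yes p | yes p′ = T.rows r c c′ p p′ c<c′ a b (∈-old q p a∈) (∈-old q′ p′ b∈)
      ... | yes p | no ¬p′ = ⊥-elim (new-west p ¬p′ q′ c<c′)
      ... | no ¬p | _      =
        subst (_≤_ b) (sym (∈-new q ¬p a∈)) (flagged r c′ q′ b b∈)

      columns : ∀ r r′ c q q′ → r < r′ → ∀ a b → a ∈ F r c q → b ∈ F r′ c q′ →
                a < b
      columns r r′ c q q′ r<r′ a b a∈ b∈ with D? r c | D? r′ c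
      ... | yes p | yes p′ = T.columns r r′ c p p′ r<r′ a b (∈-old q p a∈) (∈-old q′ p′ b∈)
      ... | no ¬p | yes p′ = ⊥-elim (new-south ¬p q p′ r<r′)
      ... | _     | no ¬p′ =
        subst (a <_) (sym (∈-new q′ ¬p′ b∈)) (ℕ.≤-<-trans (flagged r c q a a∈) r<r′)

⊆-Closure : ∀ {n} {D : Diagram n} {r c} → D r c → Closure D r c
⊆-Closure p = (_ , ℕ.≤-refl , p) , (_ , ℕ.≤-refl , p)

module _ {n} (w : Permutation′ n) where

  Rothe-irrelevant : ∀ {r c} (p p′ : Rothe w r c) → p ≡ p′
  Rothe-irrelevant (a , b) (a′ , b′) = cong₂ _,_ (ℕ.<-irrelevant a a′) (ℕ.<-irrelevant b b′)

  φ-isSingletonExtension : ∀ T → IsSingletonExtension T (φ w T)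
  φ-isSingletonExtension T = record { on-old = on-old ; on-new = on-new }
    where
      on-old : ∀ r c q p → φ w T r c q ≡ T r c p
      on-old r c q p with Rothe? w r c
      ... | yes p′ = cong (T r c) (Rothe-irrelevant p′ p)
      ... | no ¬p  = ⊥-elim (¬p p)

      on-new : ∀ r c q → ¬ Rothe w r c → φ w T r c q ≡ ⁅ r ⁆
      on-new r c q ¬p with Rothe? w r c
      ... | yes p = ⊥-elim (¬p p)
      ... | no _  = refl

  Closure-new-south : ∀ {r r′ c} → ¬ Rothe w r c → Closure (Rothe w) r c →
                      Rothe w r′ c → ¬ r < r′
  Closure-new-south ¬p ((_ , c≤j , j<wr , _) , _) (_ , r′<w⁻¹c) r<r′ =
    ¬p (ℕ.≤-<-trans c≤j j<wr , ℕ.<-trans r<r′ r′<w⁻¹c)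

  Closure-new-west : Avoids321 w → ∀ {r c c′} → Rothe w r c →
                     ¬ Rothe w r c′ → Closure (Rothe w) r c′ → ¬ c < c′
  Closure-new-west avoids {r} {c} {c′} (_ , r<w⁻¹c) ¬p′
    ((_ , c′≤j , j<wr , _) , (i , _ , c′<wi , i<w⁻¹c′)) c<c′ =
    avoids (i , w ⟨$⟩ˡ c′ , w ⟨$⟩ˡ c , i<w⁻¹c′ , w⁻¹c′<w⁻¹c ,
            subst (_< w ⟨$⟩ʳ i) (sym (inverseʳ w)) c′<wi ,
            subst₂ _<_ (sym (inverseʳ w)) (sym (inverseʳ w)) c<c′)
    where
      w⁻¹c′≤r : w ⟨$⟩ˡ c′ ≤ r
      w⁻¹c′≤r = ℕ.≮⇒≥ λ r<w⁻¹c′ → ¬p′ (ℕ.≤-<-trans c′≤j j<wr , r<w⁻¹c′)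
      w⁻¹c′<w⁻¹c : w ⟨$⟩ˡ c′ < w ⟨$⟩ˡ c
      w⁻¹c′<w⁻¹c = ℕ.≤-<-trans w⁻¹c′≤r r<w⁻¹c

claim5p3 : ∀ (n : ℕ) (w : Permutation′ n) → Avoids321 w →
    (∀ (T : Filling (Rothe w)) → IsFSVT (Rothe w) T →
       IsFSVT (Closure (Rothe w)) (φ w T))
    × (∀ (T T' : Filling (Rothe w)) → IsFSVT (Rothe w) T → IsFSVT (Rothe w) T' →
       (∀ r c q → φ w T r c q ≡ φ w T' r c q) →
       ∀ r c p → T r c p ≡ T' r c p)
claim5p3 n w avoids =
  (λ T fsvt → singletonExtension-isFSVT (φ-isSingletonExtension w T) (Rothe? w) fsvt
                (Closure-new-west w avoids) (Closure-new-south w))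
  , λ T T′ _ _ → singletonExtension-injective (φ-isSingletonExtension w T)
                   (φ-isSingletonExtension w T′) ⊆-Closure
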